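{- Let $n\ge 1$. If $\pi\in\mathcal{C}_n(312)$, then $\pi_n=1$.
   Context: A permutation $\pi=\pi_1\cdots\pi_n\in S_n$ (one-line notation, $\pi_i=\pi(i)$) contains a pattern $\sigma\in S_k$ if there are indices $i_1<\dots<i_k$ with $\pi_{i_1}\cdots\pi_{i_k}$ in the same relative order as $\sigma_1\cdots\sigma_k$; otherwise $\pi$ avoids $\sigma$. $\pi$ is cyclic if its cycle decomposition consists of a single $n$-cycle. $\mathcal{C}_n(\sigma)$ denotes the set of cyclic permutations in $S_n$ that avoid $\sigma$. -}

module Defs where

open import Data.Nat using (ℕ; zero; suc)
open import Data.Fin using (Fin; zero; suc; _<_)
open import Data.Fin.Permutation using (Permutation′; _⟨$⟩ʳ_)
open import Data.Product using (Σ; ∃; _×_)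
open import Relation.Binary.PropositionalEquality using (_≡_)
open import Relation.Nullary using (¬_)

iter : ∀ {n} → Permutation′ n → ℕ → Fin n → Fin n
iter π zero    i = i
iter π (suc k) i = π ⟨$⟩ʳ (iter π k i)

-- π is cyclic: its cycle decomposition is a single n-cycle,
-- i.e. every point lies in the orbit of every other point.
IsCyclic : ∀ {n} → Permutation′ n → Set
IsCyclic {n} π = (i j : Fin n) → ∃ λ k → iter π k i ≡ j

Contains : ∀ {n k} → Permutation′ n → (Fin k → Fin k) → Set
Contains {n} {k} π σ =
  Σ (Fin k → Fin n) λ f →
    ((a b : Fin k) → a < b → f a < f b) ×
    ((a b : Fin k) → (σ a < σ b → π ⟨$⟩ʳ f a < π ⟨$⟩ʳ f b)
                   × (π ⟨$⟩ʳ f a < π ⟨$⟩ʳ f b → σ a < σ b))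

Avoids : ∀ {n k} → Permutation′ n → (Fin k → Fin k) → Set
Avoids π σ = ¬ Contains π σ

-- the pattern 312 (0-indexed: 2 0 1)
p312 : Fin 3 → Fin 3
p312 zero = suc (suc zero)
p312 (suc zero) = zero
p312 (suc (suc zero)) = suc zero

-- Write v for the value at the last position. If some x < v had π x > v, then
-- every value u < v must sit to the left of x, since u at a position between x
-- and the last one would complete a 312 (π x, u, v); so π⁻¹ injects the v values
-- below v into the x positions below x, contradicting x < v. Hence π maps the
-- positions below v into themselves, and if v ≠ 0 the orbit of 0 never reaches
-- the last position, so π is not cyclic.
module Submission where

open import Defs
open import Data.Nat using (ℕ; zero; suc; z≤n; s≤s)
import Data.Nat.Base as ℕ
import Data.Nat.Properties as ℕ
open import Data.Fin using (Fin; zero; suc; fromℕ; fromℕ<; toℕ; inject≤; _<_; _≤_)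
open import Data.Fin.Properties
  using (<-cmp; <-trans; <-irrefl; <-asym; ≤-antisym; ≤fromℕ; ≤∧≢⇒<; toℕ<n; toℕ-injective;
         toℕ-inject≤; inject≤-injective; fromℕ<-injective; injective⇒≤)
open import Data.Fin.Permutation
  using (Permutation′; flip; _⟨$⟩ʳ_; _⟨$⟩ˡ_; inverseʳ)
open import Data.Product using (_,_; _×_)
open import Data.Empty using (⊥-elim)
open import Function.Base using (_∘_)
open import Function.Bundles using (Injection)
open import Function.Definitions using (Injective)
open import Function.Properties.Inverse using (↔⇒↣)
open import Relation.Binary.Definitions using (tri<; tri≈; tri>)
open import Relation.Binary.PropositionalEquality using (_≡_; refl; sym; trans; cong; subst)
open import Relation.Nullary using (¬_)

increasing₃ : ∀ {m} (f : Fin 3 → Fin m) → f zero < f (suc zero) →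
  f (suc zero) < f (suc (suc zero)) → (a b : Fin 3) → a < b → f a < f b
increasing₃ f p q zero             (suc zero)       _ = p
increasing₃ f p q zero             (suc (suc zero)) _ = <-trans p q
increasing₃ f p q (suc zero)       (suc (suc zero)) _ = q
increasing₃ f p q _                zero             ()
increasing₃ f p q (suc zero)       (suc zero)       (s≤s ())
increasing₃ f p q (suc (suc zero)) (suc zero)       (s≤s ())
increasing₃ f p q (suc (suc zero)) (suc (suc zero)) (s≤s (s≤s ()))

order-isomorphic-p312 : ∀ {m} (g : Fin 3 → Fin m) → g (suc zero) < g (suc (suc zero)) →
  g (suc (suc zero)) < g zero → (a b : Fin 3) →
  (p312 a < p312 b → g a < g b) × (g a < g b → p312 a < p312 b)
order-isomorphic-p312 g p q zero zero = (⊥-elim ∘ ℕ.<-irrefl refl) , (⊥-elim ∘ ℕ.<-irrefl refl)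
order-isomorphic-p312 g p q zero (suc zero) = (λ ()) , λ r → ⊥-elim (<-asym r (<-trans p q))
order-isomorphic-p312 g p q zero (suc (suc zero)) = (λ { (s≤s ()) }) , λ r → ⊥-elim (<-asym r q)
order-isomorphic-p312 g p q (suc zero) zero = (λ _ → <-trans p q) , λ _ → s≤s z≤n
order-isomorphic-p312 g p q (suc zero) (suc zero) = (⊥-elim ∘ ℕ.<-irrefl refl) , (⊥-elim ∘ ℕ.<-irrefl refl)
order-isomorphic-p312 g p q (suc zero) (suc (suc zero)) = (λ _ → p) , λ _ → s≤s z≤n
order-isomorphic-p312 g p q (suc (suc zero)) zero = (λ _ → q) , λ _ → s≤s (s≤s z≤n)
order-isomorphic-p312 g p q (suc (suc zero)) (suc zero) = (λ ()) , λ r → ⊥-elim (<-asym r p)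
order-isomorphic-p312 g p q (suc (suc zero)) (suc (suc zero)) = (⊥-elim ∘ ℕ.<-irrefl refl) , (⊥-elim ∘ ℕ.<-irrefl refl)

contains312 : ∀ {m} (π : Permutation′ m) {i j k : Fin m} → i < j → j < k →
  π ⟨$⟩ʳ j < π ⟨$⟩ʳ k → π ⟨$⟩ʳ k < π ⟨$⟩ʳ i → Contains π p312
contains312 π {i} {j} {k} i<j j<k πj<πk πk<πi =
  positions , increasing₃ positions i<j j<k , order-isomorphic-p312 ((π ⟨$⟩ʳ_) ∘ positions) πj<πk πk<πi
  where
  positions : Fin 3 → Fin _
  positions zero             = i
  positions (suc zero)       = j
  positions (suc (suc zero)) = k

injective-below⇒≤ : ∀ {m m′} {f : Fin m → Fin m′} → Injective _≡_ _≡_ f →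
  (v : Fin m) (x : Fin m′) → (∀ {u} → u < v → f u < x) → v ≤ x
injective-below⇒≤ {m} {f = f} f-injective v x below = injective⇒≤ restriction-injective
  where
  v≤m : toℕ v ℕ.≤ m
  v≤m = ℕ.<⇒≤ (toℕ<n v)

  embed : Fin (toℕ v) → Fin m
  embed w = inject≤ w v≤m

  embed<v : ∀ w → embed w < v
  embed<v w = ℕ.≤-<-trans (ℕ.≤-reflexive (toℕ-inject≤ w v≤m)) (toℕ<n w)

  restriction : Fin (toℕ v) → Fin (toℕ x)
  restriction w = fromℕ< (below (embed<v w))

  restriction-injective : Injective _≡_ _≡_ restriction
  restriction-injective {w} {w′} eq = inject≤-injective v≤m v≤m w w′
    (f-injective (toℕ-injective (fromℕ<-injective _ _ (below (embed<v w)) (below (embed<v w′)) eq)))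

iter-preserves : ∀ {m} (π : Permutation′ m) {P : Fin m → Set} →
  (∀ {x} → P x → P (π ⟨$⟩ʳ x)) → ∀ k {i} → P i → P (iter π k i)
iter-preserves π step zero    p = p
iter-preserves π {P} step (suc k) p = step (iter-preserves π {P} step k p)

module _ {n : ℕ} (π : Permutation′ (suc n)) (avoid : Avoids π p312) where

  v : Fin (suc n)
  v = π ⟨$⟩ʳ fromℕ n

  smaller-values-left-of-larger : ∀ {x u} → v < π ⟨$⟩ʳ x → u < v → π ⟨$⟩ˡ u < x
  smaller-values-left-of-larger {x} {u} v<πx u<v with <-cmp (π ⟨$⟩ˡ u) x
  ... | tri< y<x _ _ = y<x
  ... | tri≈ _ y≡x _ = ⊥-elim (<-asym u<v (subst (v <_) (trans (cong (π ⟨$⟩ʳ_) (sym y≡x)) (inverseʳ π)) v<πx))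
  ... | tri> _ _ x<y = ⊥-elim (avoid (contains312 π x<y y<last (subst (_< v) u≡πy u<v) v<πx))
    where
    u≡πy : u ≡ π ⟨$⟩ʳ (π ⟨$⟩ˡ u)
    u≡πy = sym (inverseʳ π)

    y<last : π ⟨$⟩ˡ u < fromℕ n
    y<last = ≤∧≢⇒< (≤fromℕ _) (λ y≡last → <-irrefl (trans u≡πy (cong (π ⟨$⟩ʳ_) y≡last)) u<v)

  below-v-closed : ∀ {x} → x < v → π ⟨$⟩ʳ x < v
  below-v-closed {x} x<v with <-cmp (π ⟨$⟩ʳ x) v
  ... | tri< πx<v _ _ = πx<v
  ... | tri≈ _ πx≡v _ =
    ⊥-elim (ℕ.<⇒≱ x<v (subst (v ≤_) (sym (Injection.injective (↔⇒↣ π) πx≡v)) (≤fromℕ v)))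
  ... | tri> _ _ v<πx = ⊥-elim (ℕ.<⇒≱ x<v
          (injective-below⇒≤ (Injection.injective (↔⇒↣ (flip π))) v x (smaller-values-left-of-larger v<πx)))

  last-value-not-positive : IsCyclic π → ¬ zero {n} < v
  last-value-not-positive cyclic 0<v with cyclic zero (fromℕ n)
  ... | k , orbit-reaches-last =
    ℕ.<⇒≱ (subst (_< v) orbit-reaches-last (iter-preserves π {P = _< v} below-v-closed k 0<v)) (≤fromℕ v)

mainTheorem1 : (n : ℕ) (π : Permutation′ (suc n)) → IsCyclic π → Avoids π p312 →
    π ⟨$⟩ʳ fromℕ n ≡ zero
mainTheorem1 n π cyclic avoid = ≤-antisym (ℕ.≮⇒≥ (last-value-not-positive π avoid cyclic)) z≤n
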